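{- If a graph $G$ of order at least $3$ has a universal vertex (a vertex adjacent to all other vertices), then $msd_{\gamma_{t2}}(G)=3$.
   Context: A semitotal dominating set of a graph without isolated vertices is a set $S$ of vertices such that every vertex outside $S$ has a neighbor in $S$ and every vertex of $S$ is at distance at most $2$ from another vertex of $S$; $\gamma_{t2}(G)$ is the minimum size of such a set. Subdividing an edge $uv$ $k$ times means replacing it by a path $u w_1\cdots w_k v$ with $k$ new vertices. $msd_{\gamma_{t2}}(G)$ is the minimum positive integer $k$ such that some edge of $G$, when subdivided $k$ times, yields a graph with semitotal domination number larger than $\gamma_{t2}(G)$. -}

module Defs where

open import Data.Nat using (ℕ; zero; suc; _+_; _∸_; _≤_; _<_; _≡ᵇ_)
open import Data.Bool using (Bool; true; false; _∧_; _∨_; not; T)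
open import Data.Fin using (Fin; toℕ; splitAt)
open import Data.Fin.Properties using (_≟_)
open import Data.Fin.Subset using (Subset; _∈_; _∉_; ∣_∣)
open import Data.Sum using (_⊎_; inj₁; inj₂)
open import Data.Product using (Σ; ∃; ∃-syntax; _×_; _,_)
open import Relation.Nullary using (¬_)
open import Relation.Nullary.Decidable using (⌊_⌋)
open import Relation.Binary.PropositionalEquality using (_≡_; _≢_)

Graph : ℕ → Set
Graph n = Fin n → Fin n → Bool

Adj : ∀ {n} → Graph n → Fin n → Fin n → Set
Adj G x y = T (G x y)

IsSimple : ∀ {n} → Graph n → Set
IsSimple G = (∀ x y → G x y ≡ G y x) × (∀ x → G x x ≡ false)

NoIsolated : ∀ {n} → Graph n → Set
NoIsolated {n} G = ∀ (x : Fin n) → ∃[ y ] Adj G x y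

Universal : ∀ {n} → Graph n → Fin n → Set
Universal G w = ∀ x → x ≢ w → Adj G w x

Dist≤2 : ∀ {n} → Graph n → Fin n → Fin n → Set
Dist≤2 G x y = Adj G x y ⊎ ∃[ w ] (Adj G x w × Adj G w y)

IsSemitotalDom : ∀ {n} → Graph n → Subset n → Set
IsSemitotalDom G S =
  (∀ x → x ∉ S → ∃[ y ] (y ∈ S × Adj G x y)) ×
  (∀ x → x ∈ S → ∃[ y ] (y ∈ S × y ≢ x × Dist≤2 G x y))

IsGammaT2 : ∀ {n} → Graph n → ℕ → Set
IsGammaT2 G m =
  (∃[ S ] (IsSemitotalDom G S × ∣ S ∣ ≡ m)) ×
  (∀ S → IsSemitotalDom G S → m ≤ ∣ S ∣)

-- Subdivide edge uv k times: vertices Fin (n + k); old vertices are inject+ n k,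
-- new vertex w_{i+1} is raise n i (i : Fin k), forming the path u w_1 ... w_k v.
-- (Only meaningful for k ≥ 1, which is all that is used.)
Subdivide : ∀ {n} → Graph n → Fin n → Fin n → (k : ℕ) → Graph (n + k)
Subdivide {n} G u v k a b with splitAt n a | splitAt n b
... | inj₁ x | inj₁ y = G x y ∧ not ((⌊ x ≟ u ⌋ ∧ ⌊ y ≟ v ⌋) ∨ (⌊ x ≟ v ⌋ ∧ ⌊ y ≟ u ⌋))
... | inj₁ x | inj₂ i = (⌊ x ≟ u ⌋ ∧ (toℕ i ≡ᵇ 0)) ∨ (⌊ x ≟ v ⌋ ∧ (toℕ i ≡ᵇ (k ∸ 1)))
... | inj₂ i | inj₁ x = (⌊ x ≟ u ⌋ ∧ (toℕ i ≡ᵇ 0)) ∨ (⌊ x ≟ v ⌋ ∧ (toℕ i ≡ᵇ (k ∸ 1)))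
... | inj₂ i | inj₂ j = (toℕ i ≡ᵇ suc (toℕ j)) ∨ (toℕ j ≡ᵇ suc (toℕ i))

SubdivIncreases : ∀ {n} → Graph n → Fin n → Fin n → ℕ → Set
SubdivIncreases G u v k =
  ∃[ m ] ∃[ m' ] (IsGammaT2 G m × IsGammaT2 (Subdivide G u v k) m' × m < m')

MsdGammaT2 : ∀ {n} → Graph n → ℕ → Set
MsdGammaT2 G k =
  1 ≤ k ×
  (∃[ u ] ∃[ v ] (Adj G u v × SubdivIncreases G u v k)) ×
  (∀ j → 1 ≤ j → j < k → ∀ u v → Adj G u v → ¬ SubdivIncreases G u v j)

-- Every semitotal dominating set has at least two vertices (a vertex
-- is dominated by some member, and that member has a partner), and {w, x} is
-- one for any x ≠ w, so γt2(G) = 2.  For an edge uv subdivided once or twice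
-- we exhibit a semitotal dominating set of size two in the new graph, built
-- from w and a subdivision vertex next to an end of uv not equal to w; hence
-- γt2 does not increase.  Subdividing an edge wx three times, with path
-- w a₀ a₁ a₂ x, gives γt2 = 3: the set {w, a₁, a₂} works, and conversely a
-- semitotal dominating set S contains an old vertex (dominating a third vertex
-- y) and one of a₀, a₁, a₂ (dominating a₁).  Listing the vertices within
-- distance two of each aᵢ shows that the partner of that aᵢ, or else a member
-- of S dominating the far end of the path, is a third member of S.

module Submission where

open import Defs
open import Data.Nat using (ℕ; suc; _+_; _∸_; _≤_; _<_; _≡ᵇ_; z≤n; s≤s)
open import Data.Nat.Properties using (≤-trans; ≤-antisym; ≤-reflexive; <-irrefl; +-suc; +-mono-≤; m≤n⇒m≤1+n; ≡ᵇ⇒≡; ≡⇒≡ᵇ)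
open import Data.Bool using (true; false; _∧_; _∨_; not; T)
open import Data.Bool.Properties using (∧-comm; ∨-comm; T-∧; T-∨)
open import Data.Fin using (Fin; zero; suc; toℕ; splitAt; _↑ˡ_; _↑ʳ_)
open import Data.Fin.Properties using (_≟_; splitAt-↑ˡ; splitAt-↑ʳ; splitAt⁻¹-↑ˡ; splitAt⁻¹-↑ʳ; ↑ˡ-injective; ↑ʳ-injective)
open import Data.Fin.Subset using (Subset; _∈_; _∉_; ∣_∣; ⁅_⁆; _∪_; _-_; inside; outside)
open import Data.Fin.Subset.Properties using (_∈?_; x∈p⇒∣p-x∣<∣p∣; x∈p∧x≢y⇒x∈p-y; ∣⁅x⁆∣≡1; x∈⁅x⁆; x∈⁅y⁆⇒x≡y; x∈p∪q⁺; x∈p∪q⁻)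
open import Data.Vec using (_∷_; [])
open import Data.Sum using (_⊎_; inj₁; inj₂)
open import Data.Product using (∃-syntax; _×_; _,_; proj₂)
open import Data.Product.Function.NonDependent.Propositional using (_×-⇔_)
open import Data.Sum.Function.Propositional using (_⊎-⇔_)
open import Function.Bundles using (_⇔_; mk⇔; Equivalence)
open import Function.Construct.Composition using (_⇔-∘_)
open import Function.Construct.Identity using (⇔-id)
open import Relation.Nullary using (¬_; yes; no; contradiction)
open import Relation.Nullary.Decidable using (⌊_⌋; toWitness; fromWitness)
open import Relation.Binary.PropositionalEquality using (_≡_; _≢_; refl; sym; trans; cong; cong₂; subst; ≢-sym)

open Equivalence using (to; from)

pair : ∀ {n} → Fin n → Fin n → Subset n
pair a b = ⁅ a ⁆ ∪ ⁅ b ⁆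

triple : ∀ {n} → Fin n → Fin n → Fin n → Subset n
triple a b c = ⁅ a ⁆ ∪ pair b c

∈pair-left : ∀ {n} (a b : Fin n) → a ∈ pair a b
∈pair-left a b = x∈p∪q⁺ (inj₁ (x∈⁅x⁆ a))

∈pair-right : ∀ {n} (a b : Fin n) → b ∈ pair a b
∈pair-right a b = x∈p∪q⁺ (inj₂ (x∈⁅x⁆ b))

∈pair⁻ : ∀ {n} {a b c : Fin n} → c ∈ pair a b → c ≡ a ⊎ c ≡ b
∈pair⁻ {a = a} {b} c∈ with x∈p∪q⁻ ⁅ a ⁆ ⁅ b ⁆ c∈
... | inj₁ c∈a = inj₁ (x∈⁅y⁆⇒x≡y a c∈a)
... | inj₂ c∈b = inj₂ (x∈⁅y⁆⇒x≡y b c∈b)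

∈triple-1 : ∀ {n} (a b c : Fin n) → a ∈ triple a b c
∈triple-1 a b c = x∈p∪q⁺ (inj₁ (x∈⁅x⁆ a))

∈triple-2 : ∀ {n} (a b c : Fin n) → b ∈ triple a b c
∈triple-2 a b c = x∈p∪q⁺ (inj₂ (∈pair-left b c))

∈triple-3 : ∀ {n} (a b c : Fin n) → c ∈ triple a b c
∈triple-3 a b c = x∈p∪q⁺ (inj₂ (∈pair-right b c))

∈triple⁻ : ∀ {n} {a b c d : Fin n} → d ∈ triple a b c → d ≡ a ⊎ d ≡ b ⊎ d ≡ c
∈triple⁻ {a = a} {b} {c} d∈ with x∈p∪q⁻ ⁅ a ⁆ (pair b c) d∈
... | inj₁ d∈a = inj₁ (x∈⁅y⁆⇒x≡y a d∈a)
... | inj₂ d∈bc = inj₂ (∈pair⁻ d∈bc)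

∉⇒≢ : ∀ {n} {S : Subset n} {a c} → a ∈ S → c ∉ S → c ≢ a
∉⇒≢ {S = S} a∈S c∉S refl = c∉S a∈S

∣p∪q∣≤∣p∣+∣q∣ : ∀ {n} (p q : Subset n) → ∣ p ∪ q ∣ ≤ ∣ p ∣ + ∣ q ∣
∣p∪q∣≤∣p∣+∣q∣ [] [] = z≤n
∣p∪q∣≤∣p∣+∣q∣ (outside ∷ p) (outside ∷ q) = ∣p∪q∣≤∣p∣+∣q∣ p q
∣p∪q∣≤∣p∣+∣q∣ (inside ∷ p) (outside ∷ q) = s≤s (∣p∪q∣≤∣p∣+∣q∣ p q)
∣p∪q∣≤∣p∣+∣q∣ (outside ∷ p) (inside ∷ q) =
  ≤-trans (s≤s (∣p∪q∣≤∣p∣+∣q∣ p q)) (≤-reflexive (sym (+-suc ∣ p ∣ ∣ q ∣)))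
∣p∪q∣≤∣p∣+∣q∣ (inside ∷ p) (inside ∷ q) =
  s≤s (≤-trans (m≤n⇒m≤1+n (∣p∪q∣≤∣p∣+∣q∣ p q)) (≤-reflexive (sym (+-suc ∣ p ∣ ∣ q ∣))))

∣pair∣≤2 : ∀ {n} (a b : Fin n) → ∣ pair a b ∣ ≤ 2
∣pair∣≤2 a b = ≤-trans (∣p∪q∣≤∣p∣+∣q∣ ⁅ a ⁆ ⁅ b ⁆)
  (≤-reflexive (cong₂ _+_ (∣⁅x⁆∣≡1 a) (∣⁅x⁆∣≡1 b)))

∣triple∣≤3 : ∀ {n} (a b c : Fin n) → ∣ triple a b c ∣ ≤ 3
∣triple∣≤3 a b c = ≤-trans (∣p∪q∣≤∣p∣+∣q∣ ⁅ a ⁆ (pair b c))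
  (+-mono-≤ (≤-reflexive (∣⁅x⁆∣≡1 a)) (∣pair∣≤2 b c))

removal : ∀ {n m} {p : Subset n} {x} → x ∈ p → m ≤ ∣ p - x ∣ → suc m ≤ ∣ p ∣
removal x∈p m≤ = ≤-trans (s≤s m≤) (x∈p⇒∣p-x∣<∣p∣ x∈p)

two-members : ∀ {n} {p : Subset n} {x y} → x ∈ p → y ∈ p → x ≢ y → 2 ≤ ∣ p ∣
two-members x∈p y∈p x≢y = removal x∈p (removal (x∈p∧x≢y⇒x∈p-y y∈p (≢-sym x≢y)) z≤n)

three-members : ∀ {n} {p : Subset n} {x y z} → x ∈ p → y ∈ p → z ∈ p →
  x ≢ y → x ≢ z → y ≢ z → 3 ≤ ∣ p ∣
three-members x∈p y∈p z∈p x≢y x≢z y≢z = removal x∈p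
  (two-members (x∈p∧x≢y⇒x∈p-y y∈p (≢-sym x≢y)) (x∈p∧x≢y⇒x∈p-y z∈p (≢-sym x≢z)) y≢z)

IsSymmetric : ∀ {n} → Graph n → Set
IsSymmetric {n} G = ∀ (x y : Fin n) → G x y ≡ G y x

adj-sym : ∀ {n} {G : Graph n} → IsSymmetric G → ∀ {x y} → Adj G x y → Adj G y x
adj-sym symG {x} {y} = subst T (symG x y)

Dist≤2-sym : ∀ {n} {G : Graph n} → IsSymmetric G → ∀ {x y} → Dist≤2 G x y → Dist≤2 G y x
Dist≤2-sym symG (inj₁ xy) = inj₁ (adj-sym symG xy)
Dist≤2-sym symG (inj₂ (m , xm , my)) = inj₂ (m , adj-sym symG my , adj-sym symG xm)

ClosedNbr : ∀ {n} → Graph n → Fin n → Fin n → Set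
ClosedNbr G x c = c ≡ x ⊎ Adj G x c

dominator : ∀ {n} {G : Graph n} {S} → IsSemitotalDom G S → ∀ x → ∃[ c ] (c ∈ S × ClosedNbr G x c)
dominator {S = S} (dom , _) x with x ∈? S
... | yes x∈S = x , x∈S , inj₁ refl
... | no x∉S with dom x x∉S
...   | c , c∈S , xc = c , c∈S , inj₂ xc

-- In a graph with at least one vertex, a semitotal dominating set has at least
-- two members: a dominator of that vertex and its partner.
two≤semitotal : ∀ {n} {G : Graph n} → Fin n → ∀ S → IsSemitotalDom G S → 2 ≤ ∣ S ∣
two≤semitotal x S sd@(_ , tot) with dominator sd x
... | c , c∈S , _ with tot c c∈S
...   | d , d∈S , d≢c , _ = two-members d∈S c∈S d≢c

γt2-exact : ∀ {n} {G : Graph n} {m} → ∃[ S ] (IsSemitotalDom G S × ∣ S ∣ ≤ m) →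
  (∀ T → IsSemitotalDom G T → m ≤ ∣ T ∣) → IsGammaT2 G m
γt2-exact (S , sd , ∣S∣≤m) lower = (S , sd , ≤-antisym ∣S∣≤m (lower S sd)) , lower

no-increase : ∀ {n} {G : Graph n} {u v k m S} → (∀ T → IsSemitotalDom G T → m ≤ ∣ T ∣) →
  IsSemitotalDom (Subdivide G u v k) S → ∣ S ∣ ≤ m → ¬ SubdivIncreases G u v k
no-increase {S = S} lower sd ∣S∣≤m (_ , _ , ((S₀ , sd₀ , refl) , _) , (_ , lower′) , γ<γ′) =
  <-irrefl refl (≤-trans γ<γ′ (≤-trans (lower′ S sd) (≤-trans ∣S∣≤m (lower S₀ sd₀))))

pair-semitotal : ∀ {n} {G : Graph n} {a b} → IsSymmetric G → a ≢ b → Dist≤2 G a b →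
  (∀ c → c ≢ a → c ≢ b → Adj G c a ⊎ Adj G c b) → IsSemitotalDom G (pair a b)
pair-semitotal {G = G} {a} {b} symG a≢b ab covers = dom , tot
  where
  dom : ∀ c → c ∉ pair a b → ∃[ d ] (d ∈ pair a b × Adj G c d)
  dom c c∉ with covers c (∉⇒≢ (∈pair-left a b) c∉) (∉⇒≢ (∈pair-right a b) c∉)
  ... | inj₁ ca = a , ∈pair-left a b , ca
  ... | inj₂ cb = b , ∈pair-right a b , cb
  tot : ∀ c → c ∈ pair a b → ∃[ d ] (d ∈ pair a b × d ≢ c × Dist≤2 G c d)
  tot c c∈ with ∈pair⁻ c∈
  ... | inj₁ refl = b , ∈pair-right a b , ≢-sym a≢b , ab
  ... | inj₂ refl = a , ∈pair-left a b , a≢b , Dist≤2-sym symG ab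

module Subdivision {n} (G : Graph n) (u v : Fin n) (k : ℕ) where

  G′ : Graph (n + k)
  G′ = Subdivide G u v k

  old : Fin n → Fin (n + k)
  old a = a ↑ˡ k

  new : Fin k → Fin (n + k)
  new i = n ↑ʳ i

  data Vertex : Fin (n + k) → Set where
    old-vertex : ∀ a → Vertex (old a)
    new-vertex : ∀ i → Vertex (new i)

  classify : ∀ z → Vertex z
  classify z with splitAt n z in eq
  ... | inj₁ a = subst Vertex (splitAt⁻¹-↑ˡ eq) (old-vertex a)
  ... | inj₂ i = subst Vertex (splitAt⁻¹-↑ʳ eq) (new-vertex i)

  old≢new : ∀ {a i} → old a ≢ new i
  old≢new {a} {i} e with trans (sym (splitAt-↑ˡ n a k)) (trans (cong (splitAt n) e) (splitAt-↑ʳ n k i))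
  ... | ()

  new≢old : ∀ {a i} → new i ≢ old a
  new≢old = ≢-sym old≢new

  old-≢ : ∀ {a b} → a ≢ b → old a ≢ old b
  old-≢ {a} {b} a≢b e = a≢b (↑ˡ-injective k a b e)

  new-≢ : ∀ {i j} → i ≢ j → new i ≢ new j
  new-≢ {i} {j} i≢j e = i≢j (↑ʳ-injective n i j e)

  SubdividedEdge : Fin n → Fin n → Set
  SubdividedEdge a b = (a ≡ u × b ≡ v) ⊎ (a ≡ v × b ≡ u)

  Attached : Fin n → Fin k → Set
  Attached a i = (a ≡ u × toℕ i ≡ 0) ⊎ (a ≡ v × toℕ i ≡ k ∸ 1)

  Consecutive : Fin k → Fin k → Set
  Consecutive i j = toℕ i ≡ suc (toℕ j) ⊎ toℕ j ≡ suc (toℕ i)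

  private
    T-≟ : ∀ {m} {a b : Fin m} → T ⌊ a ≟ b ⌋ ⇔ (a ≡ b)
    T-≟ = mk⇔ toWitness fromWitness

    T-≡ᵇ : ∀ {i j} → T (i ≡ᵇ j) ⇔ (i ≡ j)
    T-≡ᵇ {i} {j} = mk⇔ (≡ᵇ⇒≡ i j) (≡⇒≡ᵇ i j)

    T-not : ∀ {b} → T (not b) ⇔ (¬ T b)
    T-not {true} = mk⇔ (λ ()) (λ ¬t → ¬t _)
    T-not {false} = mk⇔ (λ _ ()) (λ _ → _)

    T-≟∧≟ : ∀ {a b c d : Fin n} → T (⌊ a ≟ b ⌋ ∧ ⌊ c ≟ d ⌋) ⇔ (a ≡ b × c ≡ d)
    T-≟∧≟ = (T-≟ ×-⇔ T-≟) ⇔-∘ T-∧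

    ¬-⇔ : ∀ {A B : Set} → A ⇔ B → (¬ A) ⇔ (¬ B)
    ¬-⇔ A⇔B = mk⇔ (λ ¬a b → ¬a (from A⇔B b)) (λ ¬b a → ¬b (to A⇔B a))

  adj-old-old : ∀ a b → Adj G′ (old a) (old b) ⇔ (Adj G a b × ¬ SubdividedEdge a b)
  adj-old-old a b rewrite splitAt-↑ˡ n a k | splitAt-↑ˡ n b k =
    (⇔-id _ ×-⇔ (¬-⇔ ((T-≟∧≟ ⊎-⇔ T-≟∧≟) ⇔-∘ T-∨) ⇔-∘ T-not)) ⇔-∘ T-∧

  adj-old-new : ∀ a i → Adj G′ (old a) (new i) ⇔ Attached a i
  adj-old-new a i rewrite splitAt-↑ˡ n a k | splitAt-↑ʳ n k i =
    (((T-≟ ×-⇔ T-≡ᵇ) ⇔-∘ T-∧) ⊎-⇔ ((T-≟ ×-⇔ T-≡ᵇ) ⇔-∘ T-∧)) ⇔-∘ T-∨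

  adj-new-new : ∀ i j → Adj G′ (new i) (new j) ⇔ Consecutive i j
  adj-new-new i j rewrite splitAt-↑ʳ n k i | splitAt-↑ʳ n k j = (T-≡ᵇ ⊎-⇔ T-≡ᵇ) ⇔-∘ T-∨

  subdivision-symmetric : IsSymmetric G → IsSymmetric G′
  subdivision-symmetric symG a b with splitAt n a | splitAt n b
  ... | inj₁ x | inj₁ y = cong₂ _∧_ (symG x y) (cong not swap-ends)
    where
    swap-ends : ((⌊ x ≟ u ⌋ ∧ ⌊ y ≟ v ⌋) ∨ (⌊ x ≟ v ⌋ ∧ ⌊ y ≟ u ⌋))
              ≡ ((⌊ y ≟ u ⌋ ∧ ⌊ x ≟ v ⌋) ∨ (⌊ y ≟ v ⌋ ∧ ⌊ x ≟ u ⌋))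
    swap-ends = trans (∨-comm (⌊ x ≟ u ⌋ ∧ ⌊ y ≟ v ⌋) (⌊ x ≟ v ⌋ ∧ ⌊ y ≟ u ⌋))
      (cong₂ _∨_ (∧-comm ⌊ x ≟ v ⌋ ⌊ y ≟ u ⌋) (∧-comm ⌊ x ≟ u ⌋ ⌊ y ≟ v ⌋))
  ... | inj₁ x | inj₂ i = refl
  ... | inj₂ i | inj₁ x = refl
  ... | inj₂ i | inj₂ j = ∨-comm (toℕ i ≡ᵇ suc (toℕ j)) (toℕ j ≡ᵇ suc (toℕ i))

  neighbour-of-old : ∀ {a z} → Adj G′ (old a) z →
    (∃[ b ] (z ≡ old b × ¬ SubdividedEdge a b)) ⊎ (∃[ i ] (z ≡ new i × Attached a i))
  neighbour-of-old {a} {z} adj with classify z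
  ... | old-vertex b = inj₁ (b , refl , proj₂ (to (adj-old-old a b) adj))
  ... | new-vertex i = inj₂ (i , refl , to (adj-old-new a i) adj)

  neighbour-of-new : IsSymmetric G → ∀ {i z} → Adj G′ (new i) z →
    (∃[ a ] (z ≡ old a × Attached a i)) ⊎ (∃[ j ] (z ≡ new j × Consecutive i j))
  neighbour-of-new symG {i} {z} adj with classify z
  ... | old-vertex a = inj₁ (a , refl , to (adj-old-new a i) (adj-sym (subdivision-symmetric symG) adj))
  ... | new-vertex j = inj₂ (j , refl , to (adj-new-new i j) adj)

  to-hub : IsSymmetric G → ∀ {w} → Universal G w → ∀ {a} → a ≢ w → ¬ SubdividedEdge a w →
    Adj G′ (old a) (old w)
  to-hub symG {w} uni {a} a≢w not-uv = from (adj-old-old a w) (adj-sym symG (uni a a≢w) , not-uv)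

  hub-via-u : ∀ {w} → Universal G w → w ≢ u → w ≢ v →
    ∀ i → toℕ i ≡ 0 → Dist≤2 G′ (old w) (new i)
  hub-via-u {w} uni w≢u w≢v i i≡0 = inj₂ (old u , w-u , from (adj-old-new u i) (inj₁ (refl , i≡0)))
    where
    w-u : Adj G′ (old w) (old u)
    w-u = from (adj-old-old w u) (uni u (≢-sym w≢u) , λ { (inj₁ (w≡u , _)) → w≢u w≡u ; (inj₂ (w≡v , _)) → w≢v w≡v })

hub-pair : ∀ {n} {G : Graph n} {w x} → IsSymmetric G → Universal G w → x ≢ w →
  IsSemitotalDom G (pair w x)
hub-pair symG uni x≢w =
  pair-semitotal symG (≢-sym x≢w) (inj₁ (uni _ x≢w)) (λ c c≢w _ → inj₁ (adj-sym symG (uni c c≢w)))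

-- Subdividing any edge once or twice in a graph with a universal vertex w
-- leaves a semitotal dominating set of size two: w and a subdivision vertex
-- next to an end of the edge other than w.
module FewSubdivisions {n} (G : Graph n) (symG : IsSymmetric G) (w : Fin n) (uni : Universal G w) where

  -- One subdivision: the new vertex is adjacent to both ends of the edge.
  once : ∀ u v → ∃[ S ] (IsSemitotalDom (Subdivide G u v 1) S × ∣ S ∣ ≤ 2)
  once u v = pair (old w) (new zero) ,
    pair-semitotal (subdivision-symmetric symG) old≢new near covers , ∣pair∣≤2 (old w) (new zero)
    where
    open Subdivision G u v 1
    near : Dist≤2 G′ (old w) (new zero)
    near with w ≟ u | w ≟ v
    ... | yes refl | _ = inj₁ (from (adj-old-new w zero) (inj₁ (refl , refl)))
    ... | no _ | yes refl = inj₁ (from (adj-old-new w zero) (inj₂ (refl , refl)))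
    ... | no w≢u | no w≢v = hub-via-u uni w≢u w≢v zero refl
    covers : ∀ c → c ≢ old w → c ≢ new zero → Adj G′ c (old w) ⊎ Adj G′ c (new zero)
    covers c c≢w c≢a₀ with classify c
    ... | new-vertex zero = contradiction refl c≢a₀
    ... | old-vertex a with a ≟ u | a ≟ v
    ...   | yes refl | _ = inj₂ (from (adj-old-new a zero) (inj₁ (refl , refl)))
    ...   | no _ | yes refl = inj₂ (from (adj-old-new a zero) (inj₂ (refl , refl)))
    ...   | no a≢u | no a≢v = inj₁ (to-hub symG uni (λ a≡w → c≢w (cong old a≡w))
            λ { (inj₁ (a≡u , _)) → a≢u a≡u ; (inj₂ (a≡v , _)) → a≢v a≡v })

  twice-away : ∀ u v → w ≢ u → ∃[ S ] (IsSemitotalDom (Subdivide G u v 2) S × ∣ S ∣ ≤ 2)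
  twice-away u v w≢u = pair (old w) (new zero) ,
    pair-semitotal (subdivision-symmetric symG) old≢new near covers , ∣pair∣≤2 (old w) (new zero)
    where
    open Subdivision G u v 2
    near : Dist≤2 G′ (old w) (new zero)
    near with w ≟ v
    ... | yes refl = inj₂ (new (suc zero) , from (adj-old-new w (suc zero)) (inj₂ (refl , refl)) ,
                           from (adj-new-new (suc zero) zero) (inj₁ refl))
    ... | no w≢v = hub-via-u uni w≢u w≢v zero refl
    covers : ∀ c → c ≢ old w → c ≢ new zero → Adj G′ c (old w) ⊎ Adj G′ c (new zero)
    covers c c≢w c≢a₀ with classify c
    ... | new-vertex zero = contradiction refl c≢a₀
    ... | new-vertex (suc zero) = inj₂ (from (adj-new-new (suc zero) zero) (inj₁ refl))
    ... | old-vertex a with a ≟ u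
    ...   | yes refl = inj₂ (from (adj-old-new a zero) (inj₁ (refl , refl)))
    ...   | no a≢u = inj₁ (to-hub symG uni (λ a≡w → c≢w (cong old a≡w))
            λ { (inj₁ (a≡u , _)) → a≢u a≡u ; (inj₂ (_ , w≡u)) → w≢u w≡u })

  twice-at-hub : ∀ v → ∃[ S ] (IsSemitotalDom (Subdivide G w v 2) S × ∣ S ∣ ≤ 2)
  twice-at-hub v = pair (old w) (new (suc zero)) ,
    pair-semitotal (subdivision-symmetric symG) old≢new near covers , ∣pair∣≤2 (old w) (new (suc zero))
    where
    open Subdivision G w v 2
    near : Dist≤2 G′ (old w) (new (suc zero))
    near = inj₂ (new zero , from (adj-old-new w zero) (inj₁ (refl , refl)) ,
                 from (adj-new-new zero (suc zero)) (inj₂ refl))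
    covers : ∀ c → c ≢ old w → c ≢ new (suc zero) → Adj G′ c (old w) ⊎ Adj G′ c (new (suc zero))
    covers c c≢w c≢a₁ with classify c
    ... | new-vertex zero = inj₂ (from (adj-new-new zero (suc zero)) (inj₂ refl))
    ... | new-vertex (suc zero) = contradiction refl c≢a₁
    ... | old-vertex a with a ≟ v
    ...   | yes refl = inj₂ (from (adj-old-new a (suc zero)) (inj₂ (refl , refl)))
    ...   | no a≢v = inj₁ (to-hub symG uni a≢w
            λ { (inj₁ (a≡w , _)) → a≢w a≡w ; (inj₂ (a≡v , _)) → a≢v a≡v })
      where
      a≢w : a ≢ w
      a≢w a≡w = c≢w (cong old a≡w)

  one-or-two : ∀ j → 1 ≤ j → j < 3 → ∀ u v → ∃[ S ] (IsSemitotalDom (Subdivide G u v j) S × ∣ S ∣ ≤ 2)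
  one-or-two 1 _ _ u v = once u v
  one-or-two 2 _ _ u v with w ≟ u
  ... | yes refl = twice-at-hub v
  ... | no w≢u = twice-away u v w≢u
  one-or-two (suc (suc (suc _))) _ (s≤s (s≤s (s≤s ())))

-- Subdividing an edge uv three times produces the path u a₀ a₁ a₂ v.
module ThreeFold {n} (G : Graph n) (symG : IsSymmetric G) (u v : Fin n) (u≢v : u ≢ v) where
  open Subdivision G u v 3

  a₀ a₁ a₂ : Fin (n + 3)
  a₀ = new zero
  a₁ = new (suc zero)
  a₂ = new (suc (suc zero))

  IsNew : Fin (n + 3) → Set
  IsNew z = ∃[ i ] (z ≡ new i)

  IsOld : Fin (n + 3) → Set
  IsOld z = ∃[ a ] (z ≡ old a)

  a₀-nbr : ∀ {z} → Adj G′ a₀ z → z ≡ old u ⊎ z ≡ a₁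
  a₀-nbr adj with neighbour-of-new symG adj
  ... | inj₁ (_ , refl , inj₁ (refl , _)) = inj₁ refl
  ... | inj₁ (_ , refl , inj₂ (_ , ()))
  ... | inj₂ (suc zero , refl , _) = inj₂ refl
  ... | inj₂ (zero , refl , inj₁ ())
  ... | inj₂ (zero , refl , inj₂ ())
  ... | inj₂ (suc (suc zero) , refl , inj₁ ())
  ... | inj₂ (suc (suc zero) , refl , inj₂ ())

  a₁-nbr : ∀ {z} → Adj G′ a₁ z → z ≡ a₀ ⊎ z ≡ a₂
  a₁-nbr adj with neighbour-of-new symG adj
  ... | inj₁ (_ , refl , inj₁ (_ , ()))
  ... | inj₁ (_ , refl , inj₂ (_ , ()))
  ... | inj₂ (zero , refl , _) = inj₁ refl
  ... | inj₂ (suc (suc zero) , refl , _) = inj₂ refl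
  ... | inj₂ (suc zero , refl , inj₁ ())
  ... | inj₂ (suc zero , refl , inj₂ ())

  a₂-nbr : ∀ {z} → Adj G′ a₂ z → z ≡ a₁ ⊎ z ≡ old v
  a₂-nbr adj with neighbour-of-new symG adj
  ... | inj₁ (_ , refl , inj₁ (_ , ()))
  ... | inj₁ (_ , refl , inj₂ (refl , _)) = inj₂ refl
  ... | inj₂ (suc zero , refl , _) = inj₁ refl
  ... | inj₂ (zero , refl , inj₁ ())
  ... | inj₂ (zero , refl , inj₂ ())
  ... | inj₂ (suc (suc zero) , refl , inj₁ ())
  ... | inj₂ (suc (suc zero) , refl , inj₂ ())

  u-nbr : ∀ {z} → Adj G′ (old u) z → z ≡ a₀ ⊎ ∃[ b ] (z ≡ old b × b ≢ v)
  u-nbr adj with neighbour-of-old adj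
  ... | inj₁ (b , refl , not-uv) = inj₂ (b , refl , λ b≡v → not-uv (inj₁ (refl , b≡v)))
  ... | inj₂ (zero , refl , _) = inj₁ refl
  ... | inj₂ (suc _ , refl , inj₁ (_ , ()))
  ... | inj₂ (_ , refl , inj₂ (u≡v , _)) = contradiction u≡v u≢v

  v-nbr : ∀ {z} → Adj G′ (old v) z → z ≡ a₂ ⊎ ∃[ b ] (z ≡ old b × b ≢ u)
  v-nbr adj with neighbour-of-old adj
  ... | inj₁ (b , refl , not-uv) = inj₂ (b , refl , λ b≡u → not-uv (inj₂ (refl , b≡u)))
  ... | inj₂ (_ , refl , inj₁ (v≡u , _)) = contradiction (sym v≡u) u≢v
  ... | inj₂ (suc (suc zero) , refl , inj₂ _) = inj₁ refl
  ... | inj₂ (zero , refl , inj₂ (_ , ()))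
  ... | inj₂ (suc zero , refl , inj₂ (_ , ()))

  off-edge-nbr : ∀ {y c} → y ≢ u → y ≢ v → ClosedNbr G′ (old y) c → IsOld c
  off-edge-nbr {y} _ _ (inj₁ refl) = y , refl
  off-edge-nbr y≢u y≢v (inj₂ adj) with neighbour-of-old adj
  ... | inj₁ (b , refl , _) = b , refl
  ... | inj₂ (_ , _ , inj₁ (y≡u , _)) = contradiction y≡u y≢u
  ... | inj₂ (_ , _ , inj₂ (y≡v , _)) = contradiction y≡v y≢v

  a₁-closed : ∀ {c} → ClosedNbr G′ a₁ c → c ≡ a₀ ⊎ c ≡ a₁ ⊎ c ≡ a₂
  a₁-closed (inj₁ refl) = inj₂ (inj₁ refl)
  a₁-closed (inj₂ adj) with a₁-nbr adj
  ... | inj₁ refl = inj₁ refl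
  ... | inj₂ refl = inj₂ (inj₂ refl)

  near-a₁ : ∀ {z} → Dist≤2 G′ a₁ z → IsNew z ⊎ z ≡ old u ⊎ z ≡ old v
  near-a₁ (inj₁ adj) with a₁-nbr adj
  ... | inj₁ refl = inj₁ (_ , refl)
  ... | inj₂ refl = inj₁ (_ , refl)
  near-a₁ (inj₂ (_ , adj₁ , adj₂)) with a₁-nbr adj₁
  near-a₁ (inj₂ (_ , _ , adj₂)) | inj₁ refl with a₀-nbr adj₂
  ... | inj₁ refl = inj₂ (inj₁ refl)
  ... | inj₂ refl = inj₁ (_ , refl)
  near-a₁ (inj₂ (_ , _ , adj₂)) | inj₂ refl with a₂-nbr adj₂
  ... | inj₁ refl = inj₁ (_ , refl)
  ... | inj₂ refl = inj₂ (inj₂ refl)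

  near-a₀ : ∀ {z} → Dist≤2 G′ a₀ z → IsNew z ⊎ ∃[ b ] (z ≡ old b × b ≢ v)
  near-a₀ (inj₁ adj) with a₀-nbr adj
  ... | inj₁ refl = inj₂ (u , refl , u≢v)
  ... | inj₂ refl = inj₁ (_ , refl)
  near-a₀ (inj₂ (_ , adj₁ , adj₂)) with a₀-nbr adj₁
  near-a₀ (inj₂ (_ , _ , adj₂)) | inj₁ refl with u-nbr adj₂
  ... | inj₁ refl = inj₁ (_ , refl)
  ... | inj₂ far = inj₂ far
  near-a₀ (inj₂ (_ , _ , adj₂)) | inj₂ refl with a₁-nbr adj₂
  ... | inj₁ refl = inj₁ (_ , refl)
  ... | inj₂ refl = inj₁ (_ , refl)

  near-a₂ : ∀ {z} → Dist≤2 G′ a₂ z → IsNew z ⊎ ∃[ b ] (z ≡ old b × b ≢ u)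
  near-a₂ (inj₁ adj) with a₂-nbr adj
  ... | inj₁ refl = inj₁ (_ , refl)
  ... | inj₂ refl = inj₂ (v , refl , ≢-sym u≢v)
  near-a₂ (inj₂ (_ , adj₁ , adj₂)) with a₂-nbr adj₁
  near-a₂ (inj₂ (_ , _ , adj₂)) | inj₁ refl with a₁-nbr adj₂
  ... | inj₁ refl = inj₁ (_ , refl)
  ... | inj₂ refl = inj₁ (_ , refl)
  near-a₂ (inj₂ (_ , _ , adj₂)) | inj₂ refl with v-nbr adj₂
  ... | inj₁ refl = inj₁ (_ , refl)
  ... | inj₂ far = inj₂ far

  -- Closed neighbourhoods that avoid a given new and a given old vertex; these
  -- supply the third member of a semitotal dominating set.
  around-u : ∀ {c} → ClosedNbr G′ (old u) c → c ≢ a₁ × c ≢ old v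
  around-u (inj₁ refl) = old≢new , old-≢ u≢v
  around-u (inj₂ adj) with u-nbr adj
  ... | inj₁ refl = new-≢ (λ ()) , new≢old
  ... | inj₂ (b , refl , b≢v) = old≢new , old-≢ b≢v

  around-v : ∀ {c} → ClosedNbr G′ (old v) c → c ≢ a₁ × c ≢ old u
  around-v (inj₁ refl) = old≢new , old-≢ (≢-sym u≢v)
  around-v (inj₂ adj) with v-nbr adj
  ... | inj₁ refl = new-≢ (λ ()) , new≢old
  ... | inj₂ (b , refl , b≢u) = old≢new , old-≢ b≢u

  around-a₀ : ∀ {b c} → b ≢ u → ClosedNbr G′ a₀ c → c ≢ a₂ × c ≢ old b
  around-a₀ _ (inj₁ refl) = new-≢ (λ ()) , new≢old
  around-a₀ b≢u (inj₂ adj) with a₀-nbr adj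
  ... | inj₁ refl = old≢new , old-≢ (≢-sym b≢u)
  ... | inj₂ refl = new-≢ (λ ()) , new≢old

  around-a₂ : ∀ {b c} → b ≢ v → ClosedNbr G′ a₂ c → c ≢ a₀ × c ≢ old b
  around-a₂ _ (inj₁ refl) = new-≢ (λ ()) , new≢old
  around-a₂ b≢v (inj₂ adj) with a₂-nbr adj
  ... | inj₁ refl = new-≢ (λ ()) , new≢old
  ... | inj₂ refl = old≢new , old-≢ (≢-sym b≢v)

  -- S contains an old vertex t
  -- (dominating y) and one of a₀, a₁, a₂ (dominating a₁); the partner of that
  -- path vertex, or a dominator at the far end of the path, is a third member.
  module LowerBound {y} (y≢u : y ≢ u) (y≢v : y ≢ v) (S : Subset (n + 3)) (sd : IsSemitotalDom G′ S) where

    three : ∀ {i a c} → new i ∈ S → old a ∈ S → c ∈ S → c ≢ new i × c ≢ old a → 3 ≤ ∣ S ∣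
    three i∈S a∈S c∈S (c≢i , c≢a) = three-members i∈S a∈S c∈S new≢old (≢-sym c≢i) (≢-sym c≢a)

    third-near : ∀ {i a} x → new i ∈ S → old a ∈ S →
      (∀ {c} → ClosedNbr G′ x c → c ≢ new i × c ≢ old a) → 3 ≤ ∣ S ∣
    third-near x i∈S a∈S avoids with dominator sd x
    ... | c , c∈S , x-c = three i∈S a∈S c∈S (avoids x-c)

    -- The dominator of y is old.
    old-member : ∃[ t ] (old t ∈ S)
    old-member with dominator sd (old y)
    ... | c , c∈S , y-c with off-edge-nbr y≢u y≢v y-c
    ...   | t , refl = t , c∈S

    from-a₁ : ∀ {t} → a₁ ∈ S → old t ∈ S → 3 ≤ ∣ S ∣
    from-a₁ a₁∈S t∈S with proj₂ sd a₁ a₁∈S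
    ... | z , z∈S , z≢a₁ , a₁-z with near-a₁ a₁-z
    ...   | inj₁ (_ , refl) = three a₁∈S t∈S z∈S (z≢a₁ , new≢old)
    ...   | inj₂ (inj₁ refl) = third-near (old v) a₁∈S z∈S around-v
    ...   | inj₂ (inj₂ refl) = third-near (old u) a₁∈S z∈S around-u

    from-a₀ : ∀ {t} → a₀ ∈ S → old t ∈ S → 3 ≤ ∣ S ∣
    from-a₀ a₀∈S t∈S with proj₂ sd a₀ a₀∈S
    ... | z , z∈S , z≢a₀ , a₀-z with near-a₀ a₀-z
    ...   | inj₁ (_ , refl) = three a₀∈S t∈S z∈S (z≢a₀ , new≢old)
    ...   | inj₂ (_ , refl , b≢v) = third-near a₂ a₀∈S z∈S (around-a₂ b≢v)

    from-a₂ : ∀ {t} → a₂ ∈ S → old t ∈ S → 3 ≤ ∣ S ∣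
    from-a₂ a₂∈S t∈S with proj₂ sd a₂ a₂∈S
    ... | z , z∈S , z≢a₂ , a₂-z with near-a₂ a₂-z
    ...   | inj₁ (_ , refl) = three a₂∈S t∈S z∈S (z≢a₂ , new≢old)
    ...   | inj₂ (_ , refl , b≢u) = third-near a₀ a₂∈S z∈S (around-a₀ b≢u)

    at-least-three : 3 ≤ ∣ S ∣
    at-least-three with old-member | dominator sd a₁
    ... | t , t∈S | c , c∈S , a₁-c with a₁-closed a₁-c
    ...   | inj₁ refl = from-a₀ c∈S t∈S
    ...   | inj₂ (inj₁ refl) = from-a₁ c∈S t∈S
    ...   | inj₂ (inj₂ refl) = from-a₂ c∈S t∈S

  lower-bound : ∀ {y} → y ≢ u → y ≢ v → ∀ S → IsSemitotalDom G′ S → 3 ≤ ∣ S ∣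
  lower-bound y≢u y≢v S sd = LowerBound.at-least-three y≢u y≢v S sd

  -- If u is universal, {u, a₁, a₂} is semitotal dominating: u dominates every
  -- old vertex except v, a₀ is adjacent to u and v to a₂.
  upper-bound : Universal G u → ∃[ S ] (IsSemitotalDom G′ S × ∣ S ∣ ≤ 3)
  upper-bound uni = triple (old u) a₁ a₂ , (dom , tot) , ∣triple∣≤3 (old u) a₁ a₂
    where
    u-a₀ : Adj G′ (old u) a₀
    u-a₀ = from (adj-old-new u zero) (inj₁ (refl , refl))
    dom : ∀ c → c ∉ triple (old u) a₁ a₂ → ∃[ d ] (d ∈ triple (old u) a₁ a₂ × Adj G′ c d)
    dom c c∉S with classify c
    ... | new-vertex zero = old u , ∈triple-1 _ _ _ , adj-sym (subdivision-symmetric symG) u-a₀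
    ... | new-vertex (suc zero) = contradiction (∈triple-2 (old u) a₁ a₂) c∉S
    ... | new-vertex (suc (suc zero)) = contradiction (∈triple-3 (old u) a₁ a₂) c∉S
    ... | old-vertex a with a ≟ v
    ...   | yes refl = a₂ , ∈triple-3 _ _ _ , from (adj-old-new a (suc (suc zero))) (inj₂ (refl , refl))
    ...   | no a≢v = old u , ∈triple-1 _ _ _ , to-hub symG uni a≢u
            λ { (inj₁ (a≡u , _)) → a≢u a≡u ; (inj₂ (a≡v , _)) → a≢v a≡v }
      where
      a≢u : a ≢ u
      a≢u a≡u = ∉⇒≢ (∈triple-1 (old u) a₁ a₂) c∉S (cong old a≡u)
    tot : ∀ c → c ∈ triple (old u) a₁ a₂ → ∃[ d ] (d ∈ triple (old u) a₁ a₂ × d ≢ c × Dist≤2 G′ c d)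
    tot c c∈S with ∈triple⁻ c∈S
    ... | inj₁ refl = a₁ , ∈triple-2 _ _ _ , new≢old ,
          inj₂ (a₀ , u-a₀ , from (adj-new-new zero (suc zero)) (inj₂ refl))
    ... | inj₂ (inj₁ refl) = a₂ , ∈triple-3 _ _ _ , new-≢ (λ ()) ,
          inj₁ (from (adj-new-new (suc zero) (suc (suc zero))) (inj₂ refl))
    ... | inj₂ (inj₂ refl) = a₁ , ∈triple-2 _ _ _ , new-≢ (λ ()) ,
          inj₁ (from (adj-new-new (suc (suc zero)) (suc zero)) (inj₁ refl))

two-others : ∀ {n} → 3 ≤ n → (w : Fin n) → ∃[ x ] ∃[ y ] (x ≢ w × y ≢ w × y ≢ x)
two-others (s≤s (s≤s (s≤s _))) zero = suc zero , suc (suc zero) , (λ ()) , (λ ()) , (λ ())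
two-others (s≤s (s≤s (s≤s _))) (suc zero) = zero , suc (suc zero) , (λ ()) , (λ ()) , (λ ())
two-others (s≤s (s≤s (s≤s _))) (suc (suc _)) = zero , suc zero , (λ ()) , (λ ()) , (λ ())

corollary2p5 : ∀ (n : ℕ) (G : Graph n) → IsSimple G → 3 ≤ n →
    ∃[ w ] Universal G w → MsdGammaT2 G 3
corollary2p5 n G (symG , _) 3≤n (w , uni) with two-others 3≤n w
... | x , y , x≢w , y≢w , y≢x =
  s≤s z≤n , (w , x , uni x x≢w , 2 , 3 , γt2-G , γt2-G′ , ≤-reflexive refl) , no-earlier
  where
  open ThreeFold G symG w x (≢-sym x≢w)
  open FewSubdivisions G symG w uni
  at-least-two : ∀ S → IsSemitotalDom G S → 2 ≤ ∣ S ∣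
  at-least-two = two≤semitotal w
  γt2-G : IsGammaT2 G 2
  γt2-G = γt2-exact (pair w x , hub-pair symG uni x≢w , ∣pair∣≤2 w x) at-least-two
  γt2-G′ : IsGammaT2 (Subdivide G w x 3) 3
  γt2-G′ = γt2-exact (upper-bound uni) (lower-bound y≢w y≢x)
  no-earlier : ∀ j → 1 ≤ j → j < 3 → ∀ a b → Adj G a b → ¬ SubdivIncreases G a b j
  no-earlier j 1≤j j<3 a b _ with one-or-two j 1≤j j<3 a b
  ... | S , sd , ∣S∣≤2 = no-increase at-least-two sd ∣S∣≤2
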